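{- For all positive integers $k$ and $r$, $\chi_{la}(S_{k}\diamond rK_{2})=4$.
   Context: All graphs are finite and simple. For a graph $G$ with $m$ edges, a bijection $f:E(G)\to\{1,2,\dots,m\}$ is a local antimagic labeling if $\omega(u)\neq\omega(v)$ for every edge $uv$, where $\omega(u)=\sum_{e\in E(u)}f(e)$ and $E(u)$ is the set of edges incident with $u$. The local antimagic chromatic number $\chi_{la}(G)$ is the minimum number of distinct values of $\omega$ over all local antimagic labelings of $G$. The star $S_k$ has a center $c$ and $k$ leaves $v_1,\dots,v_k$. $rK_2$ denotes the disjoint union of $r$ copies of $K_2$. For graphs $G,H$, the edge-corona product $G\diamond H$ is obtained from one copy of $G$ and $|E(G)|$ disjoint copies of $H$, one assigned to each edge of $G$, by joining, for each edge $uv\in E(G)$, both $u$ and $v$ to every vertex of the copy of $H$ assigned to $uv$. Thus $S_k\diamond rK_2$ has vertices $c,v_i,u_i^{j1},u_i^{j2}$ ($1\le i\le k$, $1\le j\le r$) and edges $cv_i$, $cu_i^{j1},cu_i^{j2},v_iu_i^{j1},v_iu_i^{j2},u_i^{j1}u_i^{j2}$. -}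

module Defs where

open import Data.Nat using (ℕ; zero; suc; _+_; _≤_)
import Data.Nat as ℕ
open import Data.Fin using (Fin; toℕ)
import Data.Fin as F
open import Data.Bool using (Bool; true; false)
import Data.Bool as B
open import Data.List using (List; []; _∷_; map; _++_; concatMap; length; deduplicate; allFin)
open import Data.Product using (_×_; _,_; proj₁; proj₂; Σ-syntax)
open import Relation.Binary.PropositionalEquality using (_≡_; refl; cong)
open import Relation.Binary.Definitions using (DecidableEquality)
open import Relation.Nullary using (Dec; yes; no; ¬_; _⊎-dec_)
open import Function.Bundles using (_⤖_; Bijection)
open import Data.Sum using (_⊎_)
open import Data.Nat.ListAction using (sum)

record FinGraph : Set₁ where
  field
    V        : Set
    E        : Set
    _≟V_     : DecidableEquality V
    vertices : List V          -- lists every vertex exactly once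
    edges    : List E          -- lists every edge exactly once
    ends     : E → V × V

module _ (G : FinGraph) where
  open FinGraph G

  numEdges : ℕ
  numEdges = length edges

  -- an edge labeling: a bijection f : E(G) → {1,…,m}; edge e gets label
  -- 1 + toℕ (f e)
  Labeling : Set
  Labeling = E ⤖ Fin numEdges

  label : Labeling → E → ℕ
  label f e = suc (toℕ (Bijection.to f e))

  incident? : (u : V) (e : E) → Dec ((u ≡ proj₁ (ends e)) ⊎ (u ≡ proj₂ (ends e)))
  incident? u e = (u ≟V proj₁ (ends e)) ⊎-dec (u ≟V proj₂ (ends e))

  weight : Labeling → V → ℕ
  weight f u = sum (map w edges)
    where
    w : E → ℕ
    w e with incident? u e
    ... | yes _ = label f e
    ... | no  _ = 0

  IsLocalAntimagic : Labeling → Set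
  IsLocalAntimagic f = (e : E) → ¬ (weight f (proj₁ (ends e)) ≡ weight f (proj₂ (ends e)))

  numColors : Labeling → ℕ
  numColors f = length (deduplicate ℕ._≟_ (map (weight f) vertices))

  LocalAntimagicChromaticNumberIs : ℕ → Set
  LocalAntimagicChromaticNumberIs c =
    (Σ[ f ∈ Labeling ] (IsLocalAntimagic f × numColors f ≡ c))
    × ((f : Labeling) → IsLocalAntimagic f → c ≤ numColors f)

module _ (k r : ℕ) where

  -- vertices c, v_i, u_i^{j1} (false), u_i^{j2} (true)
  data SVtx : Set where
    c : SVtx
    v : Fin k → SVtx
    u : Fin k → Fin r → Bool → SVtx

  data SEdge : Set where
    cv : Fin k → SEdge
    cu : Fin k → Fin r → Bool → SEdge
    vu : Fin k → Fin r → Bool → SEdge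
    uu : Fin k → Fin r → SEdge


module _ {k r : ℕ} where
  v-inj : ∀ {i i'} → v {k} {r} i ≡ v i' → i ≡ i'
  v-inj refl = refl

  u-inj : ∀ {i i' j j' b b'} → u {k} {r} i j b ≡ u i' j' b' → (i ≡ i') × (j ≡ j') × (b ≡ b')
  u-inj refl = refl , refl , refl

  _≟S_ : DecidableEquality (SVtx k r)
  c ≟S c = yes refl
  c ≟S v _ = no λ ()
  c ≟S u _ _ _ = no λ ()
  v _ ≟S c = no λ ()
  v i ≟S v i' with i F.≟ i'
  ... | yes refl = yes refl
  ... | no ne = no λ eq → ne (v-inj eq)
  v _ ≟S u _ _ _ = no λ ()
  u _ _ _ ≟S c = no λ ()
  u _ _ _ ≟S v _ = no λ ()
  u i j b ≟S u i' j' b' with i F.≟ i' | j F.≟ j' | b B.≟ b'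
  ... | yes refl | yes refl | yes refl = yes refl
  ... | no ne | _ | _ = no λ eq → ne (proj₁ (u-inj eq))
  ... | yes _ | no ne | _ = no λ eq → ne (proj₁ (proj₂ (u-inj eq)))
  ... | yes _ | yes _ | no ne = no λ eq → ne (proj₂ (proj₂ (u-inj eq)))

bools : List Bool
bools = false ∷ true ∷ []

StarCorona : (k r : ℕ) → FinGraph
StarCorona k r = record
  { V = SVtx k r
  ; E = SEdge k r
  ; _≟V_ = _≟S_
  ; vertices = c ∷ map v (allFin k)
      ++ concatMap (λ i → concatMap (λ j → map (u i j) bools) (allFin r)) (allFin k)
  ; edges = map cv (allFin k)
      ++ concatMap (λ i → concatMap (λ j →
            map (cu i j) bools ++ map (vu i j) bools ++ (uu i j ∷ [])) (allFin r)) (allFin k)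
  ; ends = ends
  }
  where
  ends : SEdge k r → SVtx k r × SVtx k r
  ends (cv i) = c , v i
  ends (cu i j b) = c , u i j b
  ends (vu i j b) = v i , u i j b
  ends (uu i j) = u i j false , u i j true

module Submission where

-- Indices start at 0. The vertices c, v_0, u_0^{01}, u_0^{02} span a K₄, so a local antimagic
-- labeling has at least four vertex weights. For four, let N = rk and give each of the N cells
-- (i, j) (the j-th copy of K₂ over c v_i, with its five edges) a position 0 ≤ p < N. Lay out the
-- labels in blocks: v_i u_i^{j2} gets 1 + p, u_i^{j1} u_i^{j2} gets N + 1 + p, v_i u_i^{j1} gets
-- 2N + 1 + p, c u_i^{j1} and c u_i^{j2} get 3N + 1 + 2(N - 1 - p) and the label after it, and
-- c v_i gets 5N + 1 + i. Then every u_i^{j1} has weight 8N + 1 and every u_i^{j2} has weight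
-- 6N + 2. To make the v_i agree as well, exchange the labels of c u_i^{01} and v_i u_i^{01}, and
-- apply i ↦ k - 1 - i to the cells of every row j ≥ 1 with j even, and to the star if r is even.
-- As i + (k - 1 - i) = k - 1, the rows' contributions to ω(v_i) then telescope to a value
-- independent of i. Finally 6N + 2 < 8N + 1 < ω(v_i) < ω(c).

open import Defs
open import Data.Bool using (Bool; true; false; if_then_else_)
open import Data.Fin using (Fin; zero; suc; toℕ; opposite; punchIn; inject₁; fromℕ; _↑ʳ_)
import Data.Fin.Permutation as Perm
open import Data.Fin.Properties
  using ( toℕ<n; toℕ-inject₁; toℕ-fromℕ; toℕ-↑ˡ; toℕ-↑ʳ; toℕ-combine; toℕ-cast; punchInᵢ≢i
        ; opposite-prop; opposite-involutive; +↔⊎; *↔×; 2↔Bool)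
open import Data.List using (List; []; _∷_; _++_; map; concatMap; tabulate; allFin; length)
open import Data.List.Membership.Propositional using (_∈_)
open import Data.List.Membership.Propositional.Properties
  using (∈-filter⁺; ∈-map⁺; ∈-map⁻; ∈-deduplicate⁺; ∈-deduplicate⁻; ∈-++⁺ʳ)
open import Data.List.Properties using (map-tabulate; map-++; map-∘; map-cong; filter-notAll; length-map)
open import Data.List.Relation.Binary.Subset.Propositional using (_⊆_)
import Data.List.Relation.Unary.All as All
import Data.List.Relation.Unary.Any as Any
open import Data.List.Relation.Unary.Any using (here; there)
open import Data.List.Relation.Unary.Unique.Propositional using (Unique)
open import Data.Nat using (ℕ; zero; suc; _+_; _*_; _∸_; _≤_; _<_; z≤n; s≤s; z<s)
import Data.Nat as ℕ
open import Data.Nat.ListAction using (sum)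
open import Data.Nat.ListAction.Properties using (sum-++)
open import Data.Nat.Properties
  using ( +-0-commutativeMonoid; +-identityʳ; *-identityʳ; +-assoc; +-comm; +-suc; m∸n+n≡m
        ; m<m+n; m≤m+n; +-mono-≤; +-monoʳ-≤; +-mono-<-≤; +-mono-≤-<; <⇒≤; >⇒≢; <-trans; ≤-trans
        ; ≤-antisym
        ; module ≤-Reasoning)
open import Data.Nat.Tactic.RingSolver using (solve-∀; solve)
open import Algebra.Properties.CommutativeMonoid.Sum +-0-commutativeMonoid
  using (sum-syntax; sum-cong-≗; sum-remove; sum-replicate-zero; sum-init-last)
  renaming (sum to ∑)
open import Data.Product using (_×_; _,_; proj₁; proj₂)
open import Data.Product.Algebra using (×-comm)
open import Data.Product.Function.NonDependent.Propositional using (_×-↔_)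
open import Data.Sum using (_⊎_; inj₁; inj₂)
open import Data.Sum.Function.Propositional using (_⊎-↔_)
open import Function.Base using (_∘_)
open import Function.Bundles using (Inverse; _↔_; mk↔ₛ′)
open import Function.Properties.Inverse using (↔-trans; ↔-sym; ↔-refl; ↔⇒⤖)
open import Relation.Binary.Definitions using (DecidableEquality)
open import Relation.Binary.PropositionalEquality
open import Relation.Nullary using (¬_; yes; no; does; ¬?)
open import Relation.Nullary.Decidable using (dec-true; dec-false)

-- Finite sums

sum-tabulate : ∀ n (g : Fin n → ℕ) → sum (tabulate g) ≡ ∑[ i < n ] g i
sum-tabulate zero    g = refl
sum-tabulate (suc n) g = cong (g zero +_) (sum-tabulate n (g ∘ suc))

sum-map-allFin : ∀ n (g : Fin n → ℕ) → sum (map g (allFin n)) ≡ ∑[ i < n ] g i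
sum-map-allFin n g = trans (cong sum (map-tabulate (λ i → i) g)) (sum-tabulate n g)

sum-map-concatMap : ∀ {A B : Set} (g : B → ℕ) (h : A → List B) xs →
  sum (map g (concatMap h xs)) ≡ sum (map (λ x → sum (map g (h x))) xs)
sum-map-concatMap g h []       = refl
sum-map-concatMap g h (x ∷ xs) = begin
  sum (map g (h x ++ concatMap h xs))              ≡⟨ cong sum (map-++ g (h x) _) ⟩
  sum (map g (h x) ++ map g (concatMap h xs))      ≡⟨ sum-++ (map g (h x)) _ ⟩
  sum (map g (h x)) + sum (map g (concatMap h xs)) ≡⟨ cong (sum (map g (h x)) +_) (sum-map-concatMap g h xs) ⟩
  sum (map (λ x → sum (map g (h x))) (x ∷ xs))     ∎
  where open ≡-Reasoning

length≡sum-map-1 : ∀ {A : Set} (xs : List A) → length xs ≡ sum (map (λ _ → 1) xs)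
length≡sum-map-1 []       = refl
length≡sum-map-1 (_ ∷ xs) = cong suc (length≡sum-map-1 xs)

∑-const : ∀ n a → ∑[ i < n ] a ≡ n * a
∑-const zero    a = refl
∑-const (suc n) a = cong (a +_) (∑-const n a)

∑-zero : ∀ {n} {g : Fin n → ℕ} → (∀ i → g i ≡ 0) → ∑ g ≡ 0
∑-zero {n} g≡0 = trans (sum-cong-≗ g≡0) (sum-replicate-zero n)

∑-δ : ∀ {n} {g : Fin n → ℕ} i₀ → (∀ i → i ≢ i₀ → g i ≡ 0) → ∑ g ≡ g i₀
∑-δ {suc n} {g} i₀ off = begin
  ∑ g                                ≡⟨ sum-remove g ⟩
  g i₀ + ∑[ j < n ] g (punchIn i₀ j) ≡⟨ cong (g i₀ +_) (∑-zero (λ j → off _ (punchInᵢ≢i i₀ j))) ⟩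
  g i₀ + 0                           ≡⟨ +-identityʳ _ ⟩
  g i₀                               ∎
  where open ≡-Reasoning

≤-∑ : ∀ {n} (g : Fin n → ℕ) i → g i ≤ ∑ g
≤-∑ {suc n} g i rewrite sum-remove {i = i} g = m≤m+n (g i) _

∑-mono-≤ : ∀ {n} {g h : Fin n → ℕ} → (∀ i → g i ≤ h i) → ∑ g ≤ ∑ h
∑-mono-≤ {zero}  g≤h = z≤n
∑-mono-≤ {suc n} g≤h = +-mono-≤ (g≤h zero) (∑-mono-≤ (g≤h ∘ suc))

∑-mono-< : ∀ {n} {g h : Fin (suc n) → ℕ} → (∀ i → g i < h i) → ∑ g < ∑ h
∑-mono-< g<h = +-mono-<-≤ (g<h zero) (∑-mono-≤ (<⇒≤ ∘ g<h ∘ suc))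

∑-toℕ-last : ∀ n (g : ℕ → ℕ) → ∑[ j < suc n ] g (toℕ j) ≡ ∑[ j < n ] g (toℕ j) + g n
∑-toℕ-last n g = begin
  ∑[ j < suc n ] g (toℕ j)                           ≡⟨ sum-init-last (g ∘ toℕ) ⟩
  ∑[ j < n ] g (toℕ (inject₁ j)) + g (toℕ (fromℕ n))
    ≡⟨ cong₂ _+_ (sum-cong-≗ {n} (cong g ∘ toℕ-inject₁)) (cong g (toℕ-fromℕ n)) ⟩
  ∑[ j < n ] g (toℕ j) + g n                         ∎
  where open ≡-Reasoning

<-by-gap : ∀ {a b} d → a + suc d ≡ b → a < b
<-by-gap {a} d refl = m<m+n a z<s

-- Reversal and alternation on Fin

opposite-complement : ∀ {n} (i : Fin n) → suc (toℕ (opposite i) + toℕ i) ≡ n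
opposite-complement {n} i = begin
  suc (toℕ (opposite i) + toℕ i) ≡⟨ +-suc (toℕ (opposite i)) (toℕ i) ⟨
  toℕ (opposite i) + suc (toℕ i) ≡⟨ cong (_+ suc (toℕ i)) (opposite-prop i) ⟩
  n ∸ suc (toℕ i) + suc (toℕ i)  ≡⟨ m∸n+n≡m (toℕ<n i) ⟩
  n                              ∎
  where open ≡-Reasoning

alternate : ∀ {n} → ℕ → Fin n → Fin n
alternate zero          i = opposite i
alternate (suc zero)    i = i
alternate (suc (suc m)) i = alternate m i

alternate-involutive : ∀ {n} m (i : Fin n) → alternate m (alternate m i) ≡ i
alternate-involutive zero          i = opposite-involutive i
alternate-involutive (suc zero)    i = refl
alternate-involutive (suc (suc m)) i = alternate-involutive m i

alternate-complement : ∀ {n} m (i : Fin n) → suc (toℕ (alternate m i) + toℕ (alternate (suc m) i)) ≡ n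
alternate-complement zero          i = opposite-complement i
alternate-complement (suc zero)    i = trans (cong suc (+-comm (toℕ i) _)) (opposite-complement i)
alternate-complement (suc (suc m)) i = alternate-complement m i

toℕ-↑ʳ-≡ : ∀ m {n} {i : Fin n} {t} → toℕ i ≡ t → toℕ (m ↑ʳ i) ≡ m + t
toℕ-↑ʳ-≡ m {i = i} p = trans (toℕ-↑ʳ m i) (cong (m +_) p)

infixr 1 _⊕_
_⊕_ : ∀ {A B : Set} {m n} → A ↔ Fin m → B ↔ Fin n → (A ⊎ B) ↔ Fin (m + n)
f ⊕ g = ↔-trans (f ⊎-↔ g) (↔-sym +↔⊎)

-- Weights and the number of distinct weights in a finite graph

module _ {A : Set} (_≟_ : DecidableEquality A) where
  open import Data.List.Relation.Unary.AllPairs using ([]; _∷_)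

  -- Filtering x out of ys loses at least x itself and keeps the rest of xs.
  Unique∧⊆⇒length≤ : ∀ {xs ys : List A} → Unique xs → xs ⊆ ys → length xs ≤ length ys
  Unique∧⊆⇒length≤ [] _ = z≤n
  Unique∧⊆⇒length≤ {x ∷ xs} {ys} (x∉xs ∷ xs-unique) xs⊆ys = ≤-trans
    (s≤s (Unique∧⊆⇒length≤ xs-unique λ z∈xs →
      ∈-filter⁺ x≢? (xs⊆ys (there z∈xs)) (All.lookup x∉xs z∈xs)))
    (filter-notAll x≢? ys (Any.map (λ x≡y x≢y → x≢y x≡y) (xs⊆ys (here refl))))
    where
    x≢? = λ y → ¬? (x ≟ y)

module _ (G : FinGraph) (f : Labeling G) where
  open FinGraph G

  Incident : V → E → Set
  Incident x e = (x ≡ proj₁ (ends e)) ⊎ (x ≡ proj₂ (ends e))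

  contribution : V → E → ℕ
  contribution x e = if does (incident? G x e) then label G f e else 0

  contribution-incident : ∀ x e → Incident x e → contribution x e ≡ label G f e
  contribution-incident x e p =
    cong (λ b → if b then label G f e else 0) (dec-true (incident? G x e) p)

  contribution-nonincident : ∀ x e → ¬ Incident x e → contribution x e ≡ 0
  contribution-nonincident x e ¬p =
    cong (λ b → if b then label G f e else 0) (dec-false (incident? G x e) ¬p)

  -- The left-hand side of summand≡contribution is the summand local to the definition of
  -- weight, which cannot be named; checking both declarations together lets its use fix it.
  mutual
    weight≡sum-contribution : ∀ x → weight G f x ≡ sum (map (contribution x) edges)
    weight≡sum-contribution x = cong sum (map-cong (summand≡contribution x) edges)

    summand≡contribution : ∀ x e → _ ≡ contribution x e
    summand≡contribution x e with incident? G x e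
    ... | yes p = sym (contribution-incident x e p)
    ... | no ¬p = sym (contribution-nonincident x e ¬p)

  numColors≤length : ∀ ws → (∀ x → weight G f x ∈ ws) → numColors G f ≤ length ws
  numColors≤length ws ω∈ws = Unique∧⊆⇒length≤ ℕ._≟_ (deduplicate-! ωs) λ z∈colours →
    let x , _ , z≡ωx = ∈-map⁻ (weight G f) (∈-deduplicate⁻ ℕ._≟_ ωs z∈colours)
    in subst (_∈ ws) (sym z≡ωx) (ω∈ws x)
    where
    open import Data.List.Relation.Unary.Unique.DecPropositional.Properties ℕ._≟_ using (deduplicate-!)
    ωs = map (weight G f) vertices

  length≤numColors : ∀ xs → xs ⊆ vertices → Unique (map (weight G f) xs) → length xs ≤ numColors G f
  length≤numColors xs xs⊆V distinct = subst (_≤ numColors G f) (length-map (weight G f) xs)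
    (Unique∧⊆⇒length≤ ℕ._≟_ distinct λ z∈ωxs →
      let x , x∈xs , z≡ωx = ∈-map⁻ (weight G f) z∈ωxs
      in subst (_∈ _) (sym z≡ωx) (∈-deduplicate⁺ ℕ._≟_ (∈-map⁺ (weight G f) (xs⊆V x∈xs))))

-- Weights in S_k ◇ rK₂

module _ {k r : ℕ} where
  open FinGraph (StarCorona k r) using (edges)

  cellEdges : Fin k → Fin r → List (SEdge k r)
  cellEdges i j = map (cu i j) bools ++ map (vu i j) bools ++ (uu i j ∷ [])

  sum-cellEdges : ∀ (g : SEdge k r → ℕ) i j {a b c d e} →
    g (cu i j false) ≡ a → g (cu i j true) ≡ b → g (vu i j false) ≡ c → g (vu i j true) ≡ d →
    g (uu i j) ≡ e → sum (map g (cellEdges i j)) ≡ a + (b + (c + (d + (e + 0))))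
  sum-cellEdges g i j p₁ p₂ p₃ p₄ p₅ =
    cong₂ _+_ p₁ (cong₂ _+_ p₂ (cong₂ _+_ p₃ (cong₂ _+_ p₄ (cong (_+ 0) p₅))))

  sum-edges : ∀ (g : SEdge k r → ℕ) →
    sum (map g edges) ≡ ∑[ i < k ] g (cv i) + ∑[ i < k ] ∑[ j < r ] sum (map g (cellEdges i j))
  sum-edges g = begin
    sum (map g (map cv (allFin k) ++ concatMap row (allFin k)))
      ≡⟨ cong sum (map-++ g (map cv (allFin k)) _) ⟩
    sum (map g (map cv (allFin k)) ++ map g (concatMap row (allFin k)))
      ≡⟨ sum-++ (map g (map cv (allFin k))) _ ⟩
    sum (map g (map cv (allFin k))) + sum (map g (concatMap row (allFin k)))
      ≡⟨ cong₂ _+_ (trans (cong sum (sym (map-∘ (allFin k)))) (sum-map-allFin k _)) rows ⟩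
    ∑[ i < k ] g (cv i) + ∑[ i < k ] ∑[ j < r ] sum (map g (cellEdges i j))
      ∎
    where
    open ≡-Reasoning
    row : Fin k → List (SEdge k r)
    row i = concatMap (cellEdges i) (allFin r)
    rows : sum (map g (concatMap row (allFin k))) ≡ ∑[ i < k ] ∑[ j < r ] sum (map g (cellEdges i j))
    rows = trans (sum-map-concatMap g row (allFin k)) (trans (sum-map-allFin k _) (sum-cong-≗ {k} λ i →
             trans (sum-map-concatMap g (cellEdges i) (allFin r)) (sum-map-allFin r _)))

  numEdges≡ : numEdges (StarCorona k r) ≡ k + k * (r * 5)
  numEdges≡ = begin
    length edges                           ≡⟨ length≡sum-map-1 edges ⟩
    sum (map (λ _ → 1) edges)              ≡⟨ sum-edges (λ _ → 1) ⟩
    ∑[ i < k ] 1 + ∑[ i < k ] ∑[ j < r ] 5 ≡⟨ cong₂ _+_ (∑-const k 1) (sum-cong-≗ {k} (λ _ → ∑-const r 5)) ⟩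
    k * 1 + ∑[ i < k ] (r * 5)             ≡⟨ cong₂ _+_ (*-identityʳ k) (∑-const k (r * 5)) ⟩
    k + k * (r * 5)                        ∎
    where open ≡-Reasoning

module _ {k r : ℕ} (f : Labeling (StarCorona k r)) where
  private
    G = StarCorona k r
    ℓ = label G f
    contr = contribution G f
    hit = contribution-incident G f
    miss = contribution-nonincident G f
  open FinGraph G using (edges)

  weight-c : weight G f c ≡ ∑[ i < k ] ℓ (cv i) + ∑[ i < k ] ∑[ j < r ] (ℓ (cu i j false) + ℓ (cu i j true))
  weight-c = begin
    weight G f c              ≡⟨ weight≡sum-contribution G f c ⟩
    sum (map (contr c) edges) ≡⟨ sum-edges (contr c) ⟩
    ∑[ i < k ] ℓ (cv i) + ∑[ i < k ] ∑[ j < r ] (ℓ (cu i j false) + (ℓ (cu i j true) + 0))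
      ≡⟨ cong (∑[ i < k ] ℓ (cv i) +_) (sum-cong-≗ {k} λ i → sum-cong-≗ {r} λ j →
           cong (ℓ (cu i j false) +_) (+-identityʳ _)) ⟩
    ∑[ i < k ] ℓ (cv i) + ∑[ i < k ] ∑[ j < r ] (ℓ (cu i j false) + ℓ (cu i j true)) ∎
    where open ≡-Reasoning

  weight-v : ∀ i₀ →
    weight G f (v i₀) ≡ ℓ (cv i₀) + ∑[ j < r ] (ℓ (vu i₀ j false) + ℓ (vu i₀ j true))
  weight-v i₀ = begin
    weight G f x              ≡⟨ weight≡sum-contribution G f x ⟩
    sum (map (contr x) edges) ≡⟨ sum-edges (contr x) ⟩
    ∑[ i < k ] contr x (cv i) + ∑[ i < k ] ∑[ j < r ] sum (map (contr x) (cellEdges i j))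
      ≡⟨ cong₂ _+_ (trans (∑-δ i₀ other-cv) (hit x (cv i₀) (inj₂ refl)))
                   (trans (∑-δ i₀ other-row) (sum-cong-≗ {r} own-row)) ⟩
    ℓ (cv i₀) + ∑[ j < r ] (ℓ (vu i₀ j false) + ℓ (vu i₀ j true)) ∎
    where
    open ≡-Reasoning
    x = v i₀
    other-cv : ∀ i → i ≢ i₀ → contr x (cv i) ≡ 0
    other-cv i i≢i₀ = miss x (cv i) λ { (inj₁ ()) ; (inj₂ refl) → i≢i₀ refl }
    other-row : ∀ i → i ≢ i₀ → ∑[ j < r ] sum (map (contr x) (cellEdges i j)) ≡ 0
    other-row i i≢i₀ = ∑-zero {r} λ j → sum-cellEdges (contr x) i j refl refl (far j false) (far j true) refl
      where
      far : ∀ j b → contr x (vu i j b) ≡ 0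
      far j b = miss x (vu i j b) λ { (inj₁ refl) → i≢i₀ refl ; (inj₂ ()) }
    own-row : ∀ j → sum (map (contr x) (cellEdges i₀ j)) ≡ ℓ (vu i₀ j false) + ℓ (vu i₀ j true)
    own-row j = trans (sum-cellEdges (contr x) i₀ j refl refl (near false) (near true) refl)
                      (cong (ℓ (vu i₀ j false) +_) (+-identityʳ _))
      where
      near : ∀ b → contr x (vu i₀ j b) ≡ ℓ (vu i₀ j b)
      near b = hit x (vu i₀ j b) (inj₁ refl)

  weight-u : ∀ i₀ j₀ b₀ →
    weight G f (u i₀ j₀ b₀) ≡ ℓ (cu i₀ j₀ b₀) + ℓ (vu i₀ j₀ b₀) + ℓ (uu i₀ j₀)
  weight-u i₀ j₀ b₀ = begin
    weight G f x              ≡⟨ weight≡sum-contribution G f x ⟩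
    sum (map (contr x) edges) ≡⟨ sum-edges (contr x) ⟩
    ∑[ i < k ] contr x (cv i) + ∑[ i < k ] ∑[ j < r ] sum (map (contr x) (cellEdges i j))
      ≡⟨ cong₂ _+_ (∑-zero {k} λ _ → refl)
                   (trans (∑-δ i₀ λ i i≢i₀ → ∑-zero {r} λ j → other-cell (i≢i₀ ∘ proj₁))
                          (∑-δ j₀ λ j j≢j₀ → other-cell (j≢j₀ ∘ proj₂))) ⟩
    sum (map (contr x) (cellEdges i₀ j₀)) ≡⟨ own-cell b₀ ⟩
    ℓ (cu i₀ j₀ b₀) + ℓ (vu i₀ j₀ b₀) + ℓ (uu i₀ j₀) ∎
    where
    open ≡-Reasoning
    x = u i₀ j₀ b₀
    other-cell : ∀ {i j} → ¬ (i ≡ i₀ × j ≡ j₀) → sum (map (contr x) (cellEdges i j)) ≡ 0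
    other-cell {i} {j} ≢cell = sum-cellEdges (contr x) i j (far-cu false) (far-cu true) (far-vu false) (far-vu true)
      (miss x (uu i j) λ { (inj₁ refl) → ≢cell (refl , refl) ; (inj₂ refl) → ≢cell (refl , refl) })
      where
      far-cu : ∀ b → contr x (cu i j b) ≡ 0
      far-cu b = miss x (cu i j b) λ { (inj₁ ()) ; (inj₂ refl) → ≢cell (refl , refl) }
      far-vu : ∀ b → contr x (vu i j b) ≡ 0
      far-vu b = miss x (vu i j b) λ { (inj₁ ()) ; (inj₂ refl) → ≢cell (refl , refl) }
    reassoc : ∀ a b d → a + (b + (d + 0)) ≡ a + b + d
    reassoc a b d = trans (cong (λ t → a + (b + t)) (+-identityʳ d)) (sym (+-assoc a b d))
    own-cell : ∀ b →
      sum (map (contr (u i₀ j₀ b)) (cellEdges i₀ j₀)) ≡ ℓ (cu i₀ j₀ b) + ℓ (vu i₀ j₀ b) + ℓ (uu i₀ j₀)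
    own-cell false = trans
      (sum-cellEdges (contr y) i₀ j₀
        (hit y (cu i₀ j₀ false) (inj₂ refl)) (miss y (cu i₀ j₀ true) λ { (inj₁ ()) ; (inj₂ ()) })
        (hit y (vu i₀ j₀ false) (inj₂ refl)) (miss y (vu i₀ j₀ true) λ { (inj₁ ()) ; (inj₂ ()) })
        (hit y (uu i₀ j₀) (inj₁ refl)))
      (reassoc (ℓ (cu i₀ j₀ false)) (ℓ (vu i₀ j₀ false)) (ℓ (uu i₀ j₀)))
      where y = u i₀ j₀ false
    own-cell true = trans
      (sum-cellEdges (contr y) i₀ j₀
        (miss y (cu i₀ j₀ false) λ { (inj₁ ()) ; (inj₂ ()) }) (hit y (cu i₀ j₀ true) (inj₂ refl))
        (miss y (vu i₀ j₀ false) λ { (inj₁ ()) ; (inj₂ ()) }) (hit y (vu i₀ j₀ true) (inj₂ refl))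
        (hit y (uu i₀ j₀) (inj₂ refl)))
      (reassoc (ℓ (cu i₀ j₀ true)) (ℓ (vu i₀ j₀ true)) (ℓ (uu i₀ j₀)))
      where y = u i₀ j₀ true

module _ {k r : ℕ} where
  private
    G = StarCorona (suc k) (suc r)
  open FinGraph G using (vertices)
  open import Data.List.Relation.Unary.AllPairs using ([]; _∷_)
  open import Data.List.Relation.Unary.All using ([]; _∷_)

  K₄ : List (SVtx (suc k) (suc r))
  K₄ = c ∷ v zero ∷ u zero zero false ∷ u zero zero true ∷ []

  K₄⊆vertices : K₄ ⊆ vertices
  K₄⊆vertices (here refl)                         = here refl
  K₄⊆vertices (there (here refl))                 = there (here refl)
  K₄⊆vertices (there (there (here refl)))         = there (∈-++⁺ʳ (map v (allFin (suc k))) (here refl))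
  K₄⊆vertices (there (there (there (here refl)))) = there (∈-++⁺ʳ (map v (allFin (suc k))) (there (here refl)))

  4≤numColors : ∀ g → IsLocalAntimagic G g → 4 ≤ numColors G g
  4≤numColors g antimagic = length≤numColors G g K₄ K₄⊆vertices
    ( (antimagic (cv zero) ∷ antimagic (cu zero zero false) ∷ antimagic (cu zero zero true) ∷ [])
    ∷ (antimagic (vu zero zero false) ∷ antimagic (vu zero zero true) ∷ [])
    ∷ (antimagic (uu zero zero) ∷ [])
    ∷ [] ∷ [])

-- The labeling

module Construction (k r : ℕ) where

  N : ℕ
  N = r * k

  rowShuffle : Fin r → Fin k → Fin k
  rowShuffle zero    i = i
  rowShuffle (suc j) i = alternate (suc (toℕ j)) i

  rowShuffle-involutive : ∀ j i → rowShuffle j (rowShuffle j i) ≡ i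
  rowShuffle-involutive zero    i = refl
  rowShuffle-involutive (suc j) i = alternate-involutive (suc (toℕ j)) i

  twist : SEdge k r → SEdge k r
  twist (cv i)               = cv (alternate r i)
  twist (cu i j true)        = cu (rowShuffle j i) j true
  twist (cu i zero false)    = vu i zero false
  twist (cu i (suc j) false) = cu (rowShuffle (suc j) i) (suc j) false
  twist (vu i j true)        = vu (rowShuffle j i) j true
  twist (vu i zero false)    = cu i zero false
  twist (vu i (suc j) false) = vu (rowShuffle (suc j) i) (suc j) false
  twist (uu i j)             = uu (rowShuffle j i) j

  twist-involutive : ∀ e → twist (twist e) ≡ e
  twist-involutive (cv i)               = cong cv (alternate-involutive r i)
  twist-involutive (cu i j true)        = cong (λ i′ → cu i′ j true) (rowShuffle-involutive j i)
  twist-involutive (cu i zero false)    = refl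
  twist-involutive (cu i (suc j) false) = cong (λ i′ → cu i′ (suc j) false) (rowShuffle-involutive (suc j) i)
  twist-involutive (vu i j true)        = cong (λ i′ → vu i′ j true) (rowShuffle-involutive j i)
  twist-involutive (vu i zero false)    = refl
  twist-involutive (vu i (suc j) false) = cong (λ i′ → vu i′ (suc j) false) (rowShuffle-involutive (suc j) i)
  twist-involutive (uu i j)             = cong (λ i′ → uu i′ j) (rowShuffle-involutive j i)

  Cell : Set
  Cell = Fin k × Fin r

  Blocks : Set
  Blocks = Cell ⊎ Cell ⊎ Cell ⊎ Cell × Bool ⊎ Fin k

  toBlocks : SEdge k r → Blocks
  toBlocks (vu i j true)  = inj₁ (i , j)
  toBlocks (uu i j)       = inj₂ (inj₁ (i , j))
  toBlocks (vu i j false) = inj₂ (inj₂ (inj₁ (i , j)))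
  toBlocks (cu i j b)     = inj₂ (inj₂ (inj₂ (inj₁ ((i , j) , b))))
  toBlocks (cv i)         = inj₂ (inj₂ (inj₂ (inj₂ i)))

  fromBlocks : Blocks → SEdge k r
  fromBlocks (inj₁ (i , j))                            = vu i j true
  fromBlocks (inj₂ (inj₁ (i , j)))                     = uu i j
  fromBlocks (inj₂ (inj₂ (inj₁ (i , j))))              = vu i j false
  fromBlocks (inj₂ (inj₂ (inj₂ (inj₁ ((i , j) , b))))) = cu i j b
  fromBlocks (inj₂ (inj₂ (inj₂ (inj₂ i))))             = cv i

  edge↔blocks : SEdge k r ↔ Blocks
  edge↔blocks = mk↔ₛ′ toBlocks fromBlocks
    (λ { (inj₁ _) → refl ; (inj₂ (inj₁ _)) → refl ; (inj₂ (inj₂ (inj₁ _))) → refl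
       ; (inj₂ (inj₂ (inj₂ (inj₁ _)))) → refl ; (inj₂ (inj₂ (inj₂ (inj₂ _)))) → refl })
    (λ { (cv _) → refl ; (cu _ _ _) → refl ; (vu _ _ true) → refl ; (vu _ _ false) → refl ; (uu _ _) → refl })

  cell↔ : Cell ↔ Fin N
  cell↔ = ↔-trans (×-comm _ _) (↔-sym *↔×)

  reversedCell×Bool↔ : (Cell × Bool) ↔ Fin (N * 2)
  reversedCell×Bool↔ = ↔-trans (↔-trans cell↔ Perm.reverse ×-↔ ↔-sym 2↔Bool) (↔-sym *↔×)

  M : ℕ
  M = N + (N + (N + (N * 2 + k)))

  layout : SEdge k r ↔ Fin M
  layout = ↔-trans edge↔blocks (cell↔ ⊕ cell↔ ⊕ cell↔ ⊕ reversedCell×Bool↔ ⊕ ↔-refl)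

  M≡numEdges : M ≡ numEdges (StarCorona k r)
  M≡numEdges = trans (M≡ k r) (sym (numEdges≡ {k} {r}))
    where
    M≡ : ∀ k r → r * k + (r * k + (r * k + (r * k * 2 + k))) ≡ k + k * (r * 5)
    M≡ = solve-∀

  labeling : Labeling (StarCorona k r)
  labeling = ↔⇒⤖ (↔-trans (mk↔ₛ′ twist twist twist-involutive twist-involutive)
                           (↔-trans layout (Perm.cast-id M≡numEdges)))

  -- Cell (i , j) sits at index k * j + i of a block (toℕ-combine).
  cellIndex : Fin k → Fin r → Fin N
  cellIndex i j = Inverse.to cell↔ (i , j)

  position : SEdge k r → ℕ
  position (vu i j true)  = toℕ (cellIndex i j)
  position (uu i j)       = N + toℕ (cellIndex i j)
  position (vu i j false) = N + (N + toℕ (cellIndex i j))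
  position (cu i j false) = N + (N + (N + (2 * toℕ (opposite (cellIndex i j)) + 0)))
  position (cu i j true)  = N + (N + (N + (2 * toℕ (opposite (cellIndex i j)) + 1)))
  position (cv i)         = N + (N + (N + (N * 2 + toℕ i)))

  toℕ-layout : ∀ e → toℕ (Inverse.to layout e) ≡ position e
  toℕ-layout (vu i j true)  = toℕ-↑ˡ _ _
  toℕ-layout (uu i j)       = toℕ-↑ʳ-≡ N (toℕ-↑ˡ _ _)
  toℕ-layout (vu i j false) = toℕ-↑ʳ-≡ N (toℕ-↑ʳ-≡ N (toℕ-↑ˡ _ _))
  toℕ-layout (cu i j false) = toℕ-↑ʳ-≡ N (toℕ-↑ʳ-≡ N (toℕ-↑ʳ-≡ N
    (trans (toℕ-↑ˡ _ k) (toℕ-combine (opposite (cellIndex i j)) zero))))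
  toℕ-layout (cu i j true)  = toℕ-↑ʳ-≡ N (toℕ-↑ʳ-≡ N (toℕ-↑ʳ-≡ N
    (trans (toℕ-↑ˡ _ k) (toℕ-combine (opposite (cellIndex i j)) (suc zero)))))
  toℕ-layout (cv i)         = toℕ-↑ʳ-≡ N (toℕ-↑ʳ-≡ N (toℕ-↑ʳ-≡ N (toℕ-↑ʳ (N * 2) i)))

  ℓ : SEdge k r → ℕ
  ℓ = label (StarCorona k r) labeling

  label-twist : ∀ e → ℓ e ≡ suc (position (twist e))
  label-twist e = cong suc (trans (toℕ-cast _ _) (toℕ-layout (twist e)))

  slot : Fin k → Fin r → Fin N
  slot i j = cellIndex (rowShuffle j i) j

  ℓ-cu+ℓ-vu : ∀ i j → ℓ (cu i j false) + ℓ (vu i j false) ≡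
    suc (N + (N + toℕ (slot i j))) + suc (N + (N + (N + (2 * toℕ (opposite (slot i j)) + 0))))
  ℓ-cu+ℓ-vu i zero    = cong₂ _+_ (label-twist (cu i zero false)) (label-twist (vu i zero false))
  ℓ-cu+ℓ-vu i (suc j) = trans (+-comm (ℓ (cu i (suc j) false)) _)
                              (cong₂ _+_ (label-twist (vu i (suc j) false)) (label-twist (cu i (suc j) false)))

  labeling-weight-u₁ : ∀ i j → weight (StarCorona k r) labeling (u i j false) ≡ 8 * N + 1
  labeling-weight-u₁ i j = begin
    weight (StarCorona k r) labeling (u i j false)   ≡⟨ weight-u labeling i j false ⟩
    ℓ (cu i j false) + ℓ (vu i j false) + ℓ (uu i j)
      ≡⟨ cong₂ _+_ (ℓ-cu+ℓ-vu i j) (label-twist (uu i j)) ⟩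
    suc (N + (N + p)) + suc (N + (N + (N + (2 * o + 0)))) + suc (N + p)
      ≡⟨ arith o p N (opposite-complement (slot i j)) ⟩
    8 * N + 1                                        ∎
    where
    open ≡-Reasoning
    p = toℕ (slot i j)
    o = toℕ (opposite (slot i j))
    arith : ∀ o p n → suc (o + p) ≡ n →
      suc (n + (n + p)) + suc (n + (n + (n + (2 * o + 0)))) + suc (n + p) ≡ 8 * n + 1
    arith o p _ refl = solve (o ∷ p ∷ [])

  labeling-weight-u₂ : ∀ i j → weight (StarCorona k r) labeling (u i j true) ≡ 6 * N + 2
  labeling-weight-u₂ i j = begin
    weight (StarCorona k r) labeling (u i j true) ≡⟨ weight-u labeling i j true ⟩
    ℓ (cu i j true) + ℓ (vu i j true) + ℓ (uu i j)
      ≡⟨ cong₂ _+_ (cong₂ _+_ (label-twist (cu i j true)) (label-twist (vu i j true))) (label-twist (uu i j)) ⟩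
    suc (N + (N + (N + (2 * o + 1)))) + suc p + suc (N + p)
      ≡⟨ arith o p N (opposite-complement (slot i j)) ⟩
    6 * N + 2                                     ∎
    where
    open ≡-Reasoning
    p = toℕ (slot i j)
    o = toℕ (opposite (slot i j))
    arith : ∀ o p n → suc (o + p) ≡ n → suc (n + (n + (n + (2 * o + 1)))) + suc p + suc (n + p) ≡ 6 * n + 2
    arith o p _ refl = solve (o ∷ p ∷ [])

-- The four weight classes

module Colouring (k r : ℕ) where
  open Construction (suc k) (suc r) public
  private
    G = StarCorona (suc k) (suc r)

  vShare : Fin (suc k) → Fin (suc r) → ℕ
  vShare i j = ℓ (vu i j false) + ℓ (vu i j true)

  cShare : Fin (suc k) → Fin (suc r) → ℕ
  cShare i j = ℓ (cu i j false) + ℓ (cu i j true)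

  vShare-row₀ : ∀ i → vShare i zero + toℕ i ≡ 5 * N
  vShare-row₀ i = begin
    vShare i zero + toℕ i
      ≡⟨ cong₂ _+_ (cong₂ _+_ (label-twist (vu i zero false)) (label-twist (vu i zero true))) (sym p≡i) ⟩
    suc (N + (N + (N + (2 * o + 0)))) + suc p + p ≡⟨ arith o p N (opposite-complement (slot i zero)) ⟩
    5 * N                                         ∎
    where
    open ≡-Reasoning
    p = toℕ (slot i zero)
    o = toℕ (opposite (slot i zero))
    p≡i : p ≡ toℕ i
    p≡i = toℕ-↑ˡ i _
    arith : ∀ o p n → suc (o + p) ≡ n → suc (n + (n + (n + (2 * o + 0)))) + suc p + p ≡ 5 * n
    arith o p _ refl = solve (o ∷ p ∷ [])

  rowPosition : ℕ → Fin (suc k) → ℕ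
  rowPosition m i = suc k * m + toℕ (alternate m i)

  vShareAt : ℕ → Fin (suc k) → ℕ
  vShareAt m i = suc (N + (N + rowPosition m i)) + suc (rowPosition m i)

  vShare-suc : ∀ i j → vShare i (suc j) ≡ vShareAt (suc (toℕ j)) i
  vShare-suc i j = cong₂ _+_ (trans (label-twist (vu i (suc j) false)) (cong (λ t → suc (N + (N + t))) position≡))
                             (trans (label-twist (vu i (suc j) true)) (cong suc position≡))
    where
    position≡ : toℕ (slot i (suc j)) ≡ rowPosition (suc (toℕ j)) i
    position≡ = toℕ-combine (suc j) (alternate (suc (toℕ j)) i)

  rowIncrement : ℕ → ℕ
  rowIncrement m = suc (2 * N + 2 * (suc k * m) + suc k)

  vShareAt-step : ∀ m i → vShareAt m i + toℕ (alternate (suc m) i) ≡ toℕ (alternate m i) + rowIncrement m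
  vShareAt-step m i =
    arith N (suc k * m) (toℕ (alternate m i)) (toℕ (alternate (suc m) i)) (suc k) (alternate-complement m i)
    where
    arith : ∀ n a e e′ κ → suc (e + e′) ≡ κ →
      suc (n + (n + (a + e))) + suc (a + e) + e′ ≡ e + suc (2 * n + 2 * a + κ)
    arith n a e e′ _ refl = solve (n ∷ a ∷ e ∷ e′ ∷ [])

  vShares-telescope : ∀ n i → ∑[ j < n ] vShareAt (suc (toℕ j)) i + toℕ (alternate (suc n) i)
                            ≡ toℕ i + ∑[ j < n ] rowIncrement (suc (toℕ j))
  vShares-telescope zero    i = sym (+-identityʳ (toℕ i))
  vShares-telescope (suc n) i = begin
    ΣV (suc n) + e (2 + n)          ≡⟨ cong (_+ e (2 + n)) (∑-toℕ-last n (V ∘ suc)) ⟩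
    ΣV n + V (suc n) + e (2 + n)    ≡⟨ +-assoc (ΣV n) (V (suc n)) _ ⟩
    ΣV n + (V (suc n) + e (2 + n))  ≡⟨ cong (ΣV n +_) (vShareAt-step (suc n) i) ⟩
    ΣV n + (e (suc n) + I (suc n))  ≡⟨ +-assoc (ΣV n) (e (suc n)) _ ⟨
    ΣV n + e (suc n) + I (suc n)    ≡⟨ cong (_+ I (suc n)) (vShares-telescope n i) ⟩
    toℕ i + ΣI n + I (suc n)        ≡⟨ +-assoc (toℕ i) _ _ ⟩
    toℕ i + (ΣI n + I (suc n))      ≡⟨ cong (toℕ i +_) (∑-toℕ-last n (I ∘ suc)) ⟨
    toℕ i + ΣI (suc n)              ∎
    where
    open ≡-Reasoning
    V = λ m → vShareAt m i
    I = rowIncrement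
    e = λ m → toℕ (alternate m i)
    ΣV = λ n → ∑[ j < n ] V (suc (toℕ j))
    ΣI = λ n → ∑[ j < n ] I (suc (toℕ j))

  vWeight : ℕ
  vWeight = suc (10 * N + ∑[ j < r ] rowIncrement (suc (toℕ j)))

  labeling-weight-v : ∀ i → weight G labeling (v i) ≡ vWeight
  labeling-weight-v i = begin
    weight G labeling (v i)                                  ≡⟨ weight-v labeling i ⟩
    ℓ (cv i) + (vShare i zero + ∑[ j < r ] vShare i (suc j))
      ≡⟨ cong₂ (λ a b → a + (vShare i zero + b)) (label-twist (cv i)) (sum-cong-≗ {r} (vShare-suc i)) ⟩
    suc (N + (N + (N + (N * 2 + e)))) + (vShare i zero + ∑[ j < r ] vShareAt (suc (toℕ j)) i)
      ≡⟨ arith N e (vShare i zero) _ (toℕ i) _ (vShare-row₀ i) (vShares-telescope r i) ⟩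
    vWeight                                                  ∎
    where
    open ≡-Reasoning
    e = toℕ (alternate (suc r) i)
    arith : ∀ n e s₀ a t b → s₀ + t ≡ 5 * n → a + e ≡ t + b →
      suc (n + (n + (n + (n * 2 + e)))) + (s₀ + a) ≡ suc (10 * n + b)
    arith n e s₀ a t b s₀+t≡ a+e≡ = begin
      suc (n + (n + (n + (n * 2 + e)))) + (s₀ + a) ≡⟨ solve (n ∷ e ∷ s₀ ∷ a ∷ []) ⟩
      suc (5 * n) + (s₀ + (a + e))                 ≡⟨ cong (λ x → suc (5 * n) + (s₀ + x)) a+e≡ ⟩
      suc (5 * n) + (s₀ + (t + b))                 ≡⟨ solve (n ∷ s₀ ∷ t ∷ b ∷ []) ⟩
      suc (5 * n) + (s₀ + t) + b                   ≡⟨ cong (λ x → suc (5 * n) + x + b) s₀+t≡ ⟩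
      suc (5 * n) + 5 * n + b                      ≡⟨ solve (n ∷ b ∷ []) ⟩
      suc (10 * n + b)                             ∎

  vShare<cShare : ∀ i j → vShare i j < cShare i j
  vShare<cShare i zero = <-by-gap (2 * N) (begin
    vShare i zero + suc (2 * N)
      ≡⟨ cong (_+ suc (2 * N)) (cong₂ _+_ (label-twist (vu i zero false)) (label-twist (vu i zero true))) ⟩
    suc (N + (N + (N + (2 * o + 0)))) + suc p + suc (2 * N) ≡⟨ arith N o p ⟩
    suc (N + (N + p)) + suc (N + (N + (N + (2 * o + 1))))
      ≡⟨ cong₂ _+_ (label-twist (cu i zero false)) (label-twist (cu i zero true)) ⟨
    cShare i zero                                           ∎)
    where
    open ≡-Reasoning
    p = toℕ (slot i zero)
    o = toℕ (opposite (slot i zero))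
    arith : ∀ n o p →
      suc (n + (n + (n + (2 * o + 0)))) + suc p + suc (2 * n) ≡ suc (n + (n + p)) + suc (n + (n + (n + (2 * o + 1))))
    arith = solve-∀
  vShare<cShare i (suc j) = <-by-gap (8 * o + 2 * p + 4) (begin
    vShare i (suc j) + suc (8 * o + 2 * p + 4)
      ≡⟨ cong (_+ suc (8 * o + 2 * p + 4))
              (cong₂ _+_ (label-twist (vu i (suc j) false)) (label-twist (vu i (suc j) true))) ⟩
    suc (N + (N + p)) + suc p + suc (8 * o + 2 * p + 4)     ≡⟨ arith o p N (opposite-complement (slot i (suc j))) ⟩
    suc (N + (N + (N + (2 * o + 0)))) + suc (N + (N + (N + (2 * o + 1))))
      ≡⟨ cong₂ _+_ (label-twist (cu i (suc j) false)) (label-twist (cu i (suc j) true)) ⟨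
    cShare i (suc j)                                         ∎)
    where
    open ≡-Reasoning
    p = toℕ (slot i (suc j))
    o = toℕ (opposite (slot i (suc j)))
    arith : ∀ o p n → suc (o + p) ≡ n →
      suc (n + (n + p)) + suc p + suc (8 * o + 2 * p + 4)
        ≡ suc (n + (n + (n + (2 * o + 0)))) + suc (n + (n + (n + (2 * o + 1))))
    arith o p _ refl = solve (o ∷ p ∷ [])

  cWeight : ℕ
  cWeight = weight G labeling c

  vWeight<cWeight : vWeight < cWeight
  vWeight<cWeight = begin-strict
    vWeight                                               ≡⟨ labeling-weight-v zero ⟨
    weight G labeling (v zero)                            ≡⟨ weight-v labeling zero ⟩
    ℓ (cv zero) + ∑[ j < suc r ] vShare zero j
      <⟨ +-mono-≤-< (≤-∑ (ℓ ∘ cv) zero) (∑-mono-< (vShare<cShare zero)) ⟩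
    ∑[ i < suc k ] ℓ (cv i) + ∑[ j < suc r ] cShare zero j
      ≤⟨ +-monoʳ-≤ (∑[ i < suc k ] ℓ (cv i)) (≤-∑ (λ i → ∑[ j < suc r ] cShare i j) zero) ⟩
    ∑[ i < suc k ] ℓ (cv i) + ∑[ i < suc k ] ∑[ j < suc r ] cShare i j ≡⟨ weight-c labeling ⟨
    cWeight                                               ∎
    where open ≤-Reasoning

  6N+2<8N+1 : 6 * N + 2 < 8 * N + 1
  6N+2<8N+1 = <-by-gap (2 * n) (arith n)
    where
    n = k + r * suc k
    arith : ∀ n → 6 * suc n + 2 + suc (2 * n) ≡ 8 * suc n + 1
    arith = solve-∀

  8N+1<vWeight : 8 * N + 1 < vWeight
  8N+1<vWeight = <-by-gap (2 * n + 1 + ∑[ j < r ] rowIncrement (suc (toℕ j))) (arith n _)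
    where
    n = k + r * suc k
    arith : ∀ n b → 8 * suc n + 1 + suc (2 * n + 1 + b) ≡ suc (10 * suc n + b)
    arith = solve-∀

  colour : SVtx (suc k) (suc r) → ℕ
  colour c             = cWeight
  colour (v _)         = vWeight
  colour (u _ _ false) = 8 * N + 1
  colour (u _ _ true)  = 6 * N + 2

  weight≡colour : ∀ x → weight G labeling x ≡ colour x
  weight≡colour c             = refl
  weight≡colour (v i)         = labeling-weight-v i
  weight≡colour (u i j false) = labeling-weight-u₁ i j
  weight≡colour (u i j true)  = labeling-weight-u₂ i j

  colour-proper : ∀ e → colour (proj₁ (FinGraph.ends G e)) ≢ colour (proj₂ (FinGraph.ends G e))
  colour-proper (cv _)         = >⇒≢ vWeight<cWeight
  colour-proper (cu _ _ false) = >⇒≢ (<-trans 8N+1<vWeight vWeight<cWeight)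
  colour-proper (cu _ _ true)  = >⇒≢ (<-trans 6N+2<8N+1 (<-trans 8N+1<vWeight vWeight<cWeight))
  colour-proper (vu _ _ false) = >⇒≢ 8N+1<vWeight
  colour-proper (vu _ _ true)  = >⇒≢ (<-trans 6N+2<8N+1 8N+1<vWeight)
  colour-proper (uu _ _)       = >⇒≢ 6N+2<8N+1

  labeling-antimagic : IsLocalAntimagic G labeling
  labeling-antimagic e ω≡ω = colour-proper e (trans (sym (weight≡colour _)) (trans ω≡ω (weight≡colour _)))

  labeling-numColors : numColors G labeling ≡ 4
  labeling-numColors =
    ≤-antisym (numColors≤length G labeling colours weight∈colours) (4≤numColors labeling labeling-antimagic)
    where
    colours : List ℕ
    colours = cWeight ∷ vWeight ∷ 8 * N + 1 ∷ 6 * N + 2 ∷ []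
    colour∈colours : ∀ x → colour x ∈ colours
    colour∈colours c             = here refl
    colour∈colours (v _)         = there (here refl)
    colour∈colours (u _ _ false) = there (there (here refl))
    colour∈colours (u _ _ true)  = there (there (there (here refl)))
    weight∈colours : ∀ x → weight G labeling x ∈ colours
    weight∈colours x = subst (_∈ colours) (sym (weight≡colour x)) (colour∈colours x)

mainTheorem9 : (k r : ℕ) → 1 ≤ k → 1 ≤ r →
    LocalAntimagicChromaticNumberIs (StarCorona k r) 4
mainTheorem9 (suc k) (suc r) _ _ = (labeling , labeling-antimagic , labeling-numColors) , 4≤numColors
  where open Colouring k r
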